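{- Let $\mathcal R$ be a term rewrite system and let $\mathcal P=\mathrm{WDP}(\mathcal R)$ or $\mathcal P=\mathrm{WIDP}(\mathcal R)$. If $\mathcal U(\mathcal P)\cup\mathcal P$ is compatible with a linear restricted (respectively quadratic restricted) interpretation, then the runtime complexity function $\mathrm{rc}_{\mathcal R}$ (if $\mathcal P=\mathrm{WDP}(\mathcal R)$), respectively the innermost runtime complexity function $\mathrm{rc}^{\mathrm i}_{\mathcal R}$ (if $\mathcal P=\mathrm{WIDP}(\mathcal R)$), is bounded by a linear (respectively quadratic) function. Moreover, if all compound symbols in $\mathrm{WIDP}(\mathcal R)$ are nullary and $\mathcal U(\mathrm{DP}(\mathcal R))\cup\mathrm{DP}(\mathcal R)$ is compatible with a linear (respectively quadratic) restricted interpretation, then $\mathrm{rc}^{\mathrm i}_{\mathcal R}$ is bounded by a linear (respectively quadratic) function.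
   Context: A TRS is a finite set of rules over $\mathcal F$; $\mathcal D$: root symbols of left-hand sides; constructors $\mathcal C=\mathcal F\setminus\mathcal D$. Basic terms: $f(t_1,\dots,t_n)$, $f\in\mathcal D$, $t_i\in\mathcal T(\mathcal C,\mathcal V)$. $\mathrm{dh}(s,\to)$: maximal derivation length; $\mathrm{rc}_{\mathcal R}(n)=\max\{\mathrm{dh}(t,\to_{\mathcal R})\mid t$ basic, $|t|\le n\}$, $\mathrm{rc}^{\mathrm i}_{\mathcal R}$ the same with innermost rewriting $\to^{\mathrm i}_{\mathcal R}$. $t^\sharp=f^\sharp(t_1,\dots,t_n)$ for $t=f(t_1,\dots,t_n)$ with fresh symbol $f^\sharp$. $\langle u_1,\dots,u_n\rangle_X$: $C[u_1,\dots,u_n]$ with $u_i$ rooted in $X$, $C$ free of $X$-symbols. $\mathrm{COM}(u_1)=u_1$, else $c(u_1,\dots,u_n)$ with a fresh compound symbol per rule. $\mathrm{WDP}(\mathcal R)$: $l^\sharp\to\mathrm{COM}(u_1^\sharp,\dots,u_n^\sharp)$ for $l\to r\in\mathcal R$, $r=\langle u_1,\dots,u_n\rangle_{\mathcal D\cup\mathcal V}$; $\mathrm{WIDP}(\mathcal R)$: same with $X=\mathcal D$; $\mathrm{DP}(\mathcal R)=\{l^\sharp\to u^\sharp\mid l\to r\in\mathcal R,\ u$ subterm of $r$, root of $u$ in $\mathcal D\}$. Usable rules $\mathcal U(\mathcal P)$: the rules of $\mathcal R$ whose left-hand side root is reachable, via the relation "$f\triangleright_d g$ iff some rule with left root $f$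 contains the defined symbol $g$ in its right-hand side", from a symbol occurring in a right-hand side of $\mathcal P$. A polynomial interpretation interprets each function symbol by a polynomial over $\mathbb N$ with natural coefficients, strictly monotone in all arguments; it is compatible with a TRS if for each rule and each assignment into $\mathbb N$ the value of the left side exceeds that of the right side. It is linear restricted if constructor symbols of $\mathcal R$ are interpreted by strongly linear polynomials $x_1+\dots+x_n+c$ and all other symbols by linear polynomials; quadratic restricted if instead all other symbols are interpreted by quadratic polynomials (sums of monomials of degree at most $2$). -}

module Defs where

open import Data.Nat using (ℕ; zero; suc; _+_; _*_; _<_; _≤_)
open import Data.Fin using (Fin; zero; suc; toℕ)
open import Data.Vec using (Vec; []; _∷_; lookup; _[_]≔_; fromList)
open import Data.List using (List; []; _∷_; _++_; length; map)
import Data.List as L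
open import Data.List.Membership.Propositional using (_∈_)
open import Data.List.Relation.Unary.Any using (Any; any?)
open import Data.Maybe using (Maybe; just; nothing)
import Data.Maybe.Properties as MP
open import Data.Bool using (Bool; true; false; if_then_else_)
open import Data.Product using (Σ; ∃; _×_; _,_; Σ-syntax; ∃-syntax)
open import Data.Sum using (_⊎_)
open import Data.Empty using (⊥)
open import Data.Unit using (⊤)
open import Relation.Nullary using (¬_; Dec; yes; no)
open import Relation.Nullary.Decidable using (⌊_⌋)
open import Relation.Binary.Definitions using (DecidableEquality)
open import Relation.Binary.PropositionalEquality using (_≡_)
open import Relation.Binary.Construct.Closure.ReflexiveTransitive using (Star)

record Sig : Set₁ where
  field
    Sym : Set
    ar  : Sym → ℕ
open Sig public

module _ (S : Sig) where

  data Term : Set where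
    var : ℕ → Term
    fun : (f : Sym S) → Vec Term (ar S f) → Term

  record Rule : Set where
    constructor _⇒_
    field
      lhs : Term
      rhs : Term
  open Rule public

module _ {S : Sig} where

  data _⊴_ (u : Term S) : Term S → Set where
    here  : u ⊴ u
    below : ∀ {f ts} (i : Fin (ar S f)) → u ⊴ lookup ts i → u ⊴ fun f ts

  data _◁_ (u : Term S) : Term S → Set where
    below : ∀ {f ts} (i : Fin (ar S f)) → u ⊴ lookup ts i → u ◁ fun f ts

  Occurs : Sym S → Term S → Set
  Occurs s t = Σ (Vec (Term S) (ar S s)) λ ts → fun s ts ⊴ t

  rootSym : Term S → Maybe (Sym S)
  rootSym (var _)   = nothing
  rootSym (fun f _) = just f

  mutual
    size : Term S → ℕ
    size (var _)    = 1
    size (fun f ts) = suc (sizes ts)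

    sizes : ∀ {n} → Vec (Term S) n → ℕ
    sizes []       = 0
    sizes (t ∷ ts) = size t + sizes ts

  mutual
    sub : (ℕ → Term S) → Term S → Term S
    sub σ (var x)    = σ x
    sub σ (fun f ts) = fun f (subs σ ts)

    subs : ∀ {n} → (ℕ → Term S) → Vec (Term S) n → Vec (Term S) n
    subs σ []       = []
    subs σ (t ∷ ts) = sub σ t ∷ subs σ ts

  IsTRS : List (Rule S) → Set
  IsTRS R = ∀ {ρ} → ρ ∈ R →
    (Σ (Sym S) λ f → Σ (Vec (Term S) (ar S f)) λ ts → lhs ρ ≡ fun f ts)
    × (∀ x → var x ⊴ rhs ρ → var x ⊴ lhs ρ)

  Defined : List (Rule S) → Sym S → Set
  Defined R f = Any (λ ρ → rootSym (lhs ρ) ≡ just f) R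

  defined? : DecidableEquality (Sym S) → (R : List (Rule S)) → (f : Sym S) → Dec (Defined R f)
  defined? _≟_ R f = any? (λ ρ → MP.≡-dec _≟_ (rootSym (lhs ρ)) (just f)) R

  data ConTerm (R : List (Rule S)) : Term S → Set where
    var : ∀ x → ConTerm R (var x)
    fun : ∀ {g ts} → ¬ Defined R g → (∀ i → ConTerm R (lookup ts i)) → ConTerm R (fun g ts)

  Basic : List (Rule S) → Term S → Set
  Basic R t = Σ (Sym S) λ f → Σ (Vec (Term S) (ar S f)) λ ts →
    t ≡ fun f ts × Defined R f × (∀ i → ConTerm R (lookup ts i))

  data _⊢_⟶_ (R : List (Rule S)) : Term S → Term S → Set where
    root : ∀ {ρ σ} → ρ ∈ R → R ⊢ sub σ (lhs ρ) ⟶ sub σ (rhs ρ)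
    cong : ∀ {f ts} (i : Fin (ar S f)) {u} → R ⊢ lookup ts i ⟶ u →
           R ⊢ fun f ts ⟶ fun f (ts [ i ]≔ u)

  NF : List (Rule S) → Term S → Set
  NF R t = ∀ u → ¬ (R ⊢ t ⟶ u)

  data _⊢_⟶ⁱ_ (R : List (Rule S)) : Term S → Term S → Set where
    root : ∀ {ρ σ} → ρ ∈ R → (∀ u → u ◁ sub σ (lhs ρ) → NF R u) →
           R ⊢ sub σ (lhs ρ) ⟶ⁱ sub σ (rhs ρ)
    cong : ∀ {f ts} (i : Fin (ar S f)) {u} → R ⊢ lookup ts i ⟶ⁱ u →
           R ⊢ fun f ts ⟶ⁱ fun f (ts [ i ]≔ u)

  data Deriv (_⟶_ : Term S → Term S → Set) : Term S → ℕ → Set where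
    stop : ∀ {t} → Deriv _⟶_ t 0
    step : ∀ {t u k} → t ⟶ u → Deriv _⟶_ u k → Deriv _⟶_ t (suc k)

-- Extended signature: original symbols, marked symbols f♯, and compound
-- symbols  com i n  (the fresh compound symbol of arity n for rule number i)

data ExtSym (S : Sig) : Set where
  orig  : Sym S → ExtSym S
  sharp : Sym S → ExtSym S
  com   : ℕ → ℕ → ExtSym S

Ext : Sig → Sig
Ext S = record { Sym = ExtSym S ; ar = arE }
  where
  arE : ExtSym S → ℕ
  arE (orig f)  = ar S f
  arE (sharp f) = ar S f
  arE (com i n) = n

module _ {S : Sig} where

  mutual
    lift : Term S → Term (Ext S)
    lift (var x)    = var x
    lift (fun f ts) = fun (orig f) (lifts ts)

    lifts : ∀ {n} → Vec (Term S) n → Vec (Term (Ext S)) n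
    lifts []       = []
    lifts (t ∷ ts) = lift t ∷ lifts ts

  liftRule : Rule S → Rule (Ext S)
  liftRule (l ⇒ r) = lift l ⇒ lift r

  _♯ : Term S → Term (Ext S)
  var x ♯    = var x
  fun f ts ♯ = fun (sharp f) (lifts ts)

  -- maximal subterms u₁,…,uₙ (left to right) with root in X,
  -- where X is given by a Boolean test on symbols and a flag saying
  -- whether variables belong to X.  r = ⟨u₁,…,uₙ⟩_X
  mutual
    caps : (Sym S → Bool) → Bool → Term S → List (Term S)
    caps p v (var x)    = if v then var x ∷ [] else []
    caps p v (fun f ts) = if p f then fun f ts ∷ [] else capsV p v ts

    capsV : ∀ {n} → (Sym S → Bool) → Bool → Vec (Term S) n → List (Term S)
    capsV p v []       = []
    capsV p v (t ∷ ts) = caps p v t ++ capsV p v ts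

  COM : ℕ → List (Term (Ext S)) → Term (Ext S)
  COM i (u ∷ []) = u
  COM i us       = fun (com i (length us)) (fromList us)

  module _ (_≟_ : DecidableEquality (Sym S)) (R : List (Rule S)) where

    private
      isD : Sym S → Bool
      isD f = ⌊ defined? _≟_ R f ⌋

    -- the weak (innermost) dependency pair of rule number i
    -- withVars = true: X = D ∪ V (WDP);  withVars = false: X = D (WIDP)
    wdpRule : Bool → ℕ → Rule S → Rule (Ext S)
    wdpRule withVars i (l ⇒ r) = (l ♯) ⇒ COM i (map _♯ (caps isD withVars r))

    WDP : Rule (Ext S) → Set
    WDP ρ' = Σ (Fin (length R)) λ i → ρ' ≡ wdpRule true (toℕ i) (L.lookup R i)

    WIDP : Rule (Ext S) → Set
    WIDP ρ' = Σ (Fin (length R)) λ i → ρ' ≡ wdpRule false (toℕ i) (L.lookup R i)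

  DP : List (Rule S) → Rule (Ext S) → Set
  DP R ρ' = Σ (Rule S) λ ρ → ρ ∈ R × Σ (Term S) λ u → u ⊴ rhs ρ ×
    Σ (Sym S) λ g → rootSym u ≡ just g × Defined R g × ρ' ≡ ((lhs ρ ♯) ⇒ (u ♯))

  _⊢_▷d_ : List (Rule S) → Sym S → Sym S → Set
  R ⊢ f ▷d g = Σ (Rule S) λ ρ → ρ ∈ R × rootSym (lhs ρ) ≡ just f × Defined R g × Occurs g (rhs ρ)

  U : List (Rule S) → (Rule (Ext S) → Set) → Rule (Ext S) → Set
  U R P ρ' = Σ (Rule S) λ ρ → ρ ∈ R × ρ' ≡ liftRule ρ ×
    Σ (Sym S) λ f → rootSym (lhs ρ) ≡ just f ×
    Σ (Sym S) λ g → Star (R ⊢_▷d_) g f ×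
    Σ (Rule (Ext S)) λ π → P π × Occurs (orig g) (rhs π)

  CompoundsNullary : (Rule (Ext S) → Set) → Set
  CompoundsNullary P = ∀ ρ' → P ρ' → ∀ i n →
    (Occurs (com i n) (lhs ρ') ⊎ Occurs (com i n) (rhs ρ')) → n ≡ 0

_∪_ : ∀ {A : Set} → (A → Set) → (A → Set) → A → Set
(P ∪ Q) x = P x ⊎ Q x

sumF : ∀ {n} → (Fin n → ℕ) → ℕ
sumF {zero}  f = 0
sumF {suc n} f = f zero + sumF (λ i → f (suc i))

record QPoly (n : ℕ) : Set where
  field
    c : ℕ
    a : Fin n → ℕ
    b : Fin n → Fin n → ℕ
open QPoly public

evalP : ∀ {n} → QPoly n → Vec ℕ n → ℕ
evalP p xs = c p + sumF (λ i → a p i * lookup xs i)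
                 + sumF (λ i → sumF (λ j → b p i j * (lookup xs i * lookup xs j)))

StrictMono : ∀ {n} → QPoly n → Set
StrictMono {n} p = ∀ (xs : Vec ℕ n) (i : Fin n) y → lookup xs i < y →
  evalP p xs < evalP p (xs [ i ]≔ y)

LinearP : ∀ {n} → QPoly n → Set
LinearP p = ∀ i j → b p i j ≡ 0

StronglyLinearP : ∀ {n} → QPoly n → Set
StronglyLinearP p = (∀ i j → b p i j ≡ 0) × (∀ i → a p i ≡ 1)

data Degree : Set where
  linear quadratic : Degree

DegreeOK : Degree → ∀ {n} → QPoly n → Set
DegreeOK linear    p = LinearP p
DegreeOK quadratic p = ⊤

Interp : Sig → Set
Interp S = (s : Sym S) → QPoly (ar S s)

module _ {S : Sig} (I : Interp S) (α : ℕ → ℕ) where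
  mutual
    eval : Term S → ℕ
    eval (var x)    = α x
    eval (fun f ts) = evalP (I f) (evals ts)

    evals : ∀ {n} → Vec (Term S) n → Vec ℕ n
    evals []       = []
    evals (t ∷ ts) = eval t ∷ evals ts

Compatible : ∀ {S} → Interp S → (Rule S → Set) → Set
Compatible I P = ∀ ρ → P ρ → ∀ α → eval I α (rhs ρ) < eval I α (lhs ρ)

IsConstructor : ∀ {S} → List (Rule S) → ExtSym S → Set
IsConstructor R (orig f)  = ¬ Defined R f
IsConstructor R (sharp f) = ⊥
IsConstructor R (com i n) = ⊥

Restricted : ∀ {S} → Degree → List (Rule S) → Interp (Ext S) → Set
Restricted d R I =
  (∀ s → StrictMono (I s)) ×
  (∀ s → IsConstructor R s → StronglyLinearP (I s)) ×
  (∀ s → ¬ IsConstructor R s → DegreeOK d (I s))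

BoundFn : Degree → ℕ → ℕ → ℕ → ℕ → ℕ
BoundFn linear    p q r n = p * n + q
BoundFn quadratic p q r n = p * (n * n) + q * n + r

RcBounded : ∀ {S} → Degree → List (Rule S) → (Term S → Term S → Set) → Set
RcBounded d R _⟶_ = ∃[ p ] ∃[ q ] ∃[ r ] ∀ n t → Basic R t → size t ≤ n →
  ∀ k → Deriv _⟶_ t k → k ≤ BoundFn d p q r n

module Submission where

-- Let J be a strictly monotone interpretation compatible with U(P) ∪ P.
-- Every term reachable from a basic term carries a weight (`Weight t v`):
-- a term all of whose defined symbols are usable weighs its value [t]; a
-- term f(s₁,…,sₙ) with defined root and usable arguments weighs k + [t♯];
-- a normal form weighs 0; a constructor context weighs the sum of the
-- weights of its arguments.  Every step strictly decreases the weight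
-- (`weight-decreases`): usable rules decrease [·] by compatibility with
-- U(P), and a root step at a marked redex is paid for by the (weak)
-- dependency pair of the rule, because the compound symbol dominates the
-- sum of its arguments.  So the derivation height of a basic term t is at
-- most k + [t♯] (`basic-height`).  Reinterpreting the symbols that do not
-- occur in R by plain sums preserves compatibility and bounds the constants
-- of all constructor interpretations, whence [t♯] is linear resp. quadratic
-- in |t| (`marked-basic-bound`).

open import Defs
open import Data.Nat using (ℕ; zero; suc; _+_; _*_; _<_; _≤_; z≤n; s≤s)
open import Data.Nat.Properties
open import Data.Nat.ListAction using (sum)
open import Data.Nat.ListAction.Properties using (sum-++)
open import Data.Nat.Solver using (module +-*-Solver)
open import Data.Fin using (Fin; zero; suc; toℕ)
import Data.Fin.Properties as Fin
open import Data.Vec using (Vec; []; _∷_; lookup; _[_]≔_; fromList)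
open import Data.Vec.Properties using (lookup∘update; lookup∘update′; []≔-idempotent; []≔-lookup)
open import Data.Vec.Membership.Propositional using () renaming (_∈_ to _∈ᵥ_)
open import Data.Vec.Membership.Propositional.Properties
  using (∈-fromList⁺; ∈-fromList⁻) renaming (∈-lookup to ∈ᵥ-lookup)
import Data.Vec.Relation.Unary.Any as VecAny
import Data.Vec.Relation.Unary.Any.Properties as VecAnyP
open import Data.List using (List; []; _∷_; _++_; length; map)
import Data.List as List
open import Data.List.Properties using (map-++)
open import Data.List.Membership.Propositional using (_∈_; find)
open import Data.List.Membership.Propositional.Properties using (∈-++⁺ˡ; ∈-++⁺ʳ; ∈-++⁻; ∈-map⁺; ∈-map⁻; ∈-lookup)
open import Data.List.Relation.Unary.Any using (here; there; index)
import Data.List.Relation.Unary.Any as Any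
open import Data.List.Relation.Unary.Any.Properties using (lookup-index)
open import Data.Bool using (Bool; true; false)
open import Data.Maybe using (just)
open import Data.Unit using (⊤; tt)
open import Data.Empty using (⊥-elim)
open import Data.Product using (Σ; ∃; ∃-syntax; _×_; _,_; proj₁; proj₂)
open import Data.Sum using (_⊎_; inj₁; inj₂)
open import Function using (_∘_; id)
open import Relation.Nullary using (¬_; yes; no)
open import Relation.Nullary.Decidable using (⌊_⌋)
open import Relation.Binary.Definitions using (DecidableEquality)
open import Relation.Binary.PropositionalEquality using (_≡_; refl; sym; trans; cong₂; subst; subst₂)
import Relation.Binary.PropositionalEquality as ≡
open import Relation.Binary.Construct.Closure.ReflexiveTransitive using (Star; ε; _◅_; _◅◅_)

module _ {S : Sig} where

  ⊴-trans : {u t w : Term S} → u ⊴ t → t ⊴ w → u ⊴ w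
  ⊴-trans p here        = p
  ⊴-trans p (below i q) = below i (⊴-trans p q)

  ⊴-◁-trans : {u t w : Term S} → u ⊴ t → t ◁ w → u ◁ w
  ⊴-◁-trans p (below i q) = below i (⊴-trans p q)

  ◁⇒⊴ : {u t : Term S} → u ◁ t → u ⊴ t
  ◁⇒⊴ (below i p) = below i p

  arg◁ : ∀ {f} {ts : Vec (Term S) (ar S f)} {u} → u ∈ᵥ ts → u ◁ fun f ts
  arg◁ {u = u} u∈ts = below (VecAny.index u∈ts) (subst (u ⊴_) (VecAnyP.lookup-index u∈ts) here)

  ⊴-update : ∀ {n} {w u : Term S} (ts : Vec (Term S) n) i j →
             w ⊴ lookup (ts [ i ]≔ u) j → w ⊴ u ⊎ w ⊴ lookup ts j
  ⊴-update ts i j p with i Fin.≟ j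
  ... | yes refl = inj₁ (subst (_ ⊴_) (lookup∘update i ts _) p)
  ... | no  i≢j  = inj₂ (subst (_ ⊴_) (lookup∘update′ (i≢j ∘ sym) ts _) p)

  root-occurs : ∀ {f} (t : Term S) → rootSym t ≡ just f → Occurs f t
  root-occurs (fun f ts) refl = ts , here

  lookup-subs : ∀ {n} (σ : ℕ → Term S) (ts : Vec (Term S) n) i → lookup (subs σ ts) i ≡ sub σ (lookup ts i)
  lookup-subs σ (t ∷ ts) zero    = refl
  lookup-subs σ (t ∷ ts) (suc i) = lookup-subs σ ts i

  var⊴⇒⊴sub : ∀ {x} (σ : ℕ → Term S) {t} → var x ⊴ t → σ x ⊴ sub σ t
  var⊴⇒⊴sub σ here = here
  var⊴⇒⊴sub σ {fun f ts} (below i p) = below i (subst (σ _ ⊴_) (sym (lookup-subs σ ts i)) (var⊴⇒⊴sub σ p))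

  mutual
    sub-occurs⁻ : ∀ (σ : ℕ → Term S) t {g us} → fun g us ⊴ sub σ t →
      (Σ _ λ vs → fun g vs ⊴ t) ⊎ (Σ ℕ λ x → var x ⊴ t × fun g us ⊴ σ x)
    sub-occurs⁻ σ (var x)    p    = inj₂ (x , here , p)
    sub-occurs⁻ σ (fun f ts) here = inj₁ (ts , here)
    sub-occurs⁻ σ (fun f ts) (below i p) with subs-occurs⁻ σ ts i p
    ... | inj₁ (vs , q)     = inj₁ (vs , below i q)
    ... | inj₂ (x , q , r) = inj₂ (x , below i q , r)

    subs-occurs⁻ : ∀ {n} (σ : ℕ → Term S) (ts : Vec (Term S) n) i {g us} → fun g us ⊴ lookup (subs σ ts) i →
      (Σ _ λ vs → fun g vs ⊴ lookup ts i) ⊎ (Σ ℕ λ x → var x ⊴ lookup ts i × fun g us ⊴ σ x)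
    subs-occurs⁻ σ (t ∷ ts) zero    p = sub-occurs⁻ σ t p
    subs-occurs⁻ σ (t ∷ ts) (suc i) p = subs-occurs⁻ σ ts i p

  lhs-root-defined : ∀ {R : List (Rule S)} {ρ f ls} → ρ ∈ R → lhs ρ ≡ fun f ls → Defined R f
  lhs-root-defined ρ∈R lhs≡ = Any.map (λ { refl → ≡.cong rootSym lhs≡ }) ρ∈R

  redex-root-defined : ∀ {R : List (Rule S)} → IsTRS R → ∀ {ρ σ c cs} → ρ ∈ R →
                       fun c cs ≡ sub σ (lhs ρ) → Defined R c
  redex-root-defined trs {σ = σ} ρ∈R redex with trs ρ∈R
  ... | (f , ls , lhs≡) , _ with trans redex (≡.cong (sub σ) lhs≡)
  ...   | refl = lhs-root-defined ρ∈R lhs≡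

  -- A variable of a right-hand side is instantiated strictly below the redex,
  -- since it occurs in the left-hand side, which is not a variable.
  rhs-var◁redex : ∀ {R : List (Rule S)} → IsTRS R → ∀ {ρ} → ρ ∈ R → ∀ σ {x} →
                  var x ⊴ rhs ρ → σ x ◁ sub σ (lhs ρ)
  rhs-var◁redex trs ρ∈R σ {x} x∈r with trs ρ∈R
  ... | (f , ls , lhs≡) , vars⊆ with subst (var x ⊴_) lhs≡ (vars⊆ x x∈r)
  ...   | below i p = subst (λ l → σ x ◁ sub σ l) (sym lhs≡)
                        (below i (subst (σ x ⊴_) (sym (lookup-subs σ ls i)) (var⊴⇒⊴sub σ p)))

  conTerm-no-defined : ∀ {R : List (Rule S)} {t g us} → ConTerm R t → fun g us ⊴ t → ¬ Defined R g
  conTerm-no-defined (fun nd _) here        = nd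
  conTerm-no-defined (fun _ cs) (below i p) = conTerm-no-defined (cs i) p

module _ {S : Sig} where

  mutual
    lift-sub : ∀ (σ : ℕ → Term S) t → lift (sub σ t) ≡ sub (lift ∘ σ) (lift t)
    lift-sub σ (var x)    = refl
    lift-sub σ (fun f ts) = ≡.cong (fun (orig f)) (lifts-subs σ ts)

    lifts-subs : ∀ {n} (σ : ℕ → Term S) (ts : Vec (Term S) n) → lifts (subs σ ts) ≡ subs (lift ∘ σ) (lifts ts)
    lifts-subs σ []       = refl
    lifts-subs σ (t ∷ ts) = cong₂ _∷_ (lift-sub σ t) (lifts-subs σ ts)

  ♯-sub : ∀ (σ : ℕ → Term S) f ts → sub σ (fun f ts) ♯ ≡ sub (lift ∘ σ) (fun f ts ♯)
  ♯-sub σ f ts = ≡.cong (fun (sharp f)) (lifts-subs σ ts)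

  lifts-update : ∀ {n} (ts : Vec (Term S) n) i u → lifts (ts [ i ]≔ u) ≡ lifts ts [ i ]≔ lift u
  lifts-update (t ∷ ts) zero    u = refl
  lifts-update (t ∷ ts) (suc i) u = ≡.cong (lift t ∷_) (lifts-update ts i u)

  lookup-lifts : ∀ {n} (ts : Vec (Term S) n) i → lookup (lifts ts) i ≡ lift (lookup ts i)
  lookup-lifts (t ∷ ts) zero    = refl
  lookup-lifts (t ∷ ts) (suc i) = lookup-lifts ts i

  mutual
    lift-occurs⁻ : ∀ t {s us} → fun (orig s) us ⊴ lift t → Occurs s t
    lift-occurs⁻ (fun f ts) here = ts , here
    lift-occurs⁻ (fun f ts) (below i p) with lifts-occurs⁻ ts i p
    ... | vs , q = vs , below i q

    lifts-occurs⁻ : ∀ {n} (ts : Vec (Term S) n) i {s us} → fun (orig s) us ⊴ lookup (lifts ts) i →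
                    Σ _ λ vs → fun s vs ⊴ lookup ts i
    lifts-occurs⁻ (t ∷ ts) zero    p = lift-occurs⁻ t p
    lifts-occurs⁻ (t ∷ ts) (suc i) p = lifts-occurs⁻ ts i p

  ♯-occurs⁻ : ∀ (t : Term S) {s us} → _⊴_ {S = Ext S} (fun (orig s) us) (t ♯) → Occurs s t
  ♯-occurs⁻ (fun f ts) (below i p) with lifts-occurs⁻ ts i p
  ... | vs , q = vs , below i q

  lift-occurs⁺ : ∀ {t s vs} → fun s vs ⊴ t → fun (orig s) (lifts vs) ⊴ lift t
  lift-occurs⁺ here = here
  lift-occurs⁺ {fun f ts} (below i p) = below i (subst (_ ⊴_) (sym (lookup-lifts ts i)) (lift-occurs⁺ p))

  ♯-occurs⁺ : ∀ {t s vs} → fun s vs ◁ t → fun (orig s) (lifts vs) ⊴ (t ♯)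
  ♯-occurs⁺ {fun f ts} (below i p) = below i (subst (_ ⊴_) (sym (lookup-lifts ts i)) (lift-occurs⁺ p))

sumF-cong : ∀ {n} {f g : Fin n → ℕ} → (∀ i → f i ≡ g i) → sumF f ≡ sumF g
sumF-cong {zero}  h = refl
sumF-cong {suc n} h = cong₂ _+_ (h zero) (sumF-cong (h ∘ suc))

sumF-mono : ∀ {n} {f g : Fin n → ℕ} → (∀ i → f i ≤ g i) → sumF f ≤ sumF g
sumF-mono {zero}  h = z≤n
sumF-mono {suc n} h = +-mono-≤ (h zero) (sumF-mono (h ∘ suc))

sumF-zero : ∀ {n} {f : Fin n → ℕ} → (∀ i → f i ≡ 0) → sumF f ≡ 0
sumF-zero {zero}  h = refl
sumF-zero {suc n} h = cong₂ _+_ (h zero) (sumF-zero (h ∘ suc))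

sumF-*ʳ : ∀ {n} (f : Fin n → ℕ) m → sumF (λ i → f i * m) ≡ sumF f * m
sumF-*ʳ {zero}  f m = refl
sumF-*ʳ {suc n} f m = trans (≡.cong (f zero * m +_) (sumF-*ʳ (f ∘ suc) m)) (sym (*-distribʳ-+ m (f zero) _))

vsum : ∀ {n} → Vec ℕ n → ℕ
vsum xs = sumF (lookup xs)

lookup≤vsum : ∀ {n} (xs : Vec ℕ n) i → lookup xs i ≤ vsum xs
lookup≤vsum (x ∷ xs) zero    = m≤m+n x _
lookup≤vsum (x ∷ xs) (suc i) = ≤-trans (lookup≤vsum xs i) (m≤n+m _ x)

vsum-update< : ∀ {n} (xs : Vec ℕ n) i y → lookup xs i < y → vsum xs < vsum (xs [ i ]≔ y)
vsum-update< (x ∷ xs) zero    y lt = +-monoˡ-< _ lt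
vsum-update< (x ∷ xs) (suc i) y lt = +-monoʳ-< x (vsum-update< xs i y lt)

∈⇒≤sum : ∀ {A : Set} (h : A → ℕ) {x} xs → x ∈ xs → h x ≤ sum (map h xs)
∈⇒≤sum h (x ∷ xs) (here refl) = m≤m+n (h x) _
∈⇒≤sum h (x ∷ xs) (there x∈)  = ≤-trans (∈⇒≤sum h xs x∈) (m≤n+m _ (h x))

StrictlyMonotone : ∀ {n} → (Vec ℕ n → ℕ) → Set
StrictlyMonotone {n} g = ∀ (xs : Vec ℕ n) i y → lookup xs i < y → g xs < g (xs [ i ]≔ y)

strictMono-dec : ∀ {n} (g : Vec ℕ n → ℕ) → StrictlyMonotone g → ∀ xs i y → y < lookup xs i → g (xs [ i ]≔ y) < g xs
strictMono-dec g mono xs i y lt = subst (λ zs → g (xs [ i ]≔ y) < g zs) restore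
                                    (mono (xs [ i ]≔ y) i (lookup xs i) (subst (_< lookup xs i) (sym (lookup∘update i xs y)) lt))
  where
  restore : (xs [ i ]≔ y) [ i ]≔ lookup xs i ≡ xs
  restore = trans ([]≔-idempotent xs i) ([]≔-lookup xs i)

head-contribution : ∀ {n} (g : Vec ℕ (suc n) → ℕ) → StrictlyMonotone g → ∀ x xs → x + g (0 ∷ xs) ≤ g (x ∷ xs)
head-contribution g mono zero    xs = ≤-refl
head-contribution g mono (suc x) xs = ≤-trans (s≤s (head-contribution g mono x xs)) (mono (x ∷ xs) zero (suc x) (n<1+n x))

vsum≤ : ∀ {n} (g : Vec ℕ n → ℕ) → StrictlyMonotone g → ∀ xs → vsum xs ≤ g xs
vsum≤ g mono []       = z≤n
vsum≤ g mono (x ∷ xs) = ≤-trans (+-monoʳ-≤ x (vsum≤ (g ∘ (0 ∷_)) (λ ys i → mono (0 ∷ ys) (suc i)) xs))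
                                (head-contribution g mono x xs)

stronglyLinear-eval : ∀ {n} (p : QPoly n) → StronglyLinearP p → ∀ xs → evalP p xs ≡ c p + vsum xs
stronglyLinear-eval p (b≡0 , a≡1) xs = trans (cong₂ _+_ (≡.cong (c p +_) linear-part) quadratic-part) (+-identityʳ _)
  where
  linear-part : sumF (λ i → a p i * lookup xs i) ≡ vsum xs
  linear-part = sumF-cong (λ i → trans (≡.cong (_* lookup xs i) (a≡1 i)) (*-identityˡ _))
  quadratic-part : sumF (λ i → sumF (λ j → b p i j * (lookup xs i * lookup xs j))) ≡ 0
  quadratic-part = sumF-zero (λ i → sumF-zero (λ j → ≡.cong (_* (lookup xs i * lookup xs j)) (b≡0 i j)))

stronglyLinear⇒strictMono : ∀ {n} (p : QPoly n) → StronglyLinearP p → StrictMono p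
stronglyLinear⇒strictMono p sl xs i y lt =
  subst₂ _<_ (sym (stronglyLinear-eval p sl xs)) (sym (stronglyLinear-eval p sl (xs [ i ]≔ y)))
         (+-monoʳ-< (c p) (vsum-update< xs i y lt))

sumPoly : ∀ n → QPoly n
sumPoly n = record { c = 0 ; a = λ _ → 1 ; b = λ _ _ → 0 }

sumPoly-stronglyLinear : ∀ n → StronglyLinearP (sumPoly n)
sumPoly-stronglyLinear n = (λ _ _ → refl) , (λ _ → refl)

poly-bound : ∀ {n} (p : QPoly n) xs M → (∀ i → lookup xs i ≤ M) →
             evalP p xs ≤ c p + sumF (a p) * M + sumF (λ i → sumF (b p i)) * (M * M)
poly-bound p xs M xs≤M = +-mono-≤ (+-monoʳ-≤ (c p) linear-part) quadratic-part
  where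
  linear-part : sumF (λ i → a p i * lookup xs i) ≤ sumF (a p) * M
  linear-part = ≤-trans (sumF-mono (λ i → *-monoʳ-≤ (a p i) (xs≤M i))) (≤-reflexive (sumF-*ʳ (a p) M))
  row : ∀ i → sumF (λ j → b p i j * (lookup xs i * lookup xs j)) ≤ sumF (b p i) * (M * M)
  row i = ≤-trans (sumF-mono (λ j → *-monoʳ-≤ (b p i j) (*-mono-≤ (xs≤M i) (xs≤M j)))) (≤-reflexive (sumF-*ʳ (b p i) (M * M)))
  quadratic-part : sumF (λ i → sumF (λ j → b p i j * (lookup xs i * lookup xs j))) ≤ sumF (λ i → sumF (b p i)) * (M * M)
  quadratic-part = ≤-trans (sumF-mono row) (≤-reflexive (sumF-*ʳ (λ i → sumF (b p i)) (M * M)))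

linear-no-quadratic : ∀ {n} (p : QPoly n) → LinearP p → sumF (λ i → sumF (b p i)) ≡ 0
linear-no-quadratic p b≡0 = sumF-zero (λ i → sumF-zero (b≡0 i))

α₀ : ℕ → ℕ
α₀ _ = 0

module _ {S : Sig} (I : Interp S) where

  mutual
    eval-sub : ∀ α (τ : ℕ → Term S) t → eval I α (sub τ t) ≡ eval I (eval I α ∘ τ) t
    eval-sub α τ (var x)    = refl
    eval-sub α τ (fun f ts) = ≡.cong (evalP (I f)) (evals-subs α τ ts)

    evals-subs : ∀ {n} α (τ : ℕ → Term S) (ts : Vec (Term S) n) → evals I α (subs τ ts) ≡ evals I (eval I α ∘ τ) ts
    evals-subs α τ []       = refl
    evals-subs α τ (t ∷ ts) = cong₂ _∷_ (eval-sub α τ t) (evals-subs α τ ts)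

  evals-update : ∀ {n} α (ts : Vec (Term S) n) i u → evals I α (ts [ i ]≔ u) ≡ evals I α ts [ i ]≔ eval I α u
  evals-update α (t ∷ ts) zero    u = refl
  evals-update α (t ∷ ts) (suc i) u = ≡.cong (eval I α t ∷_) (evals-update α ts i u)

  lookup-evals : ∀ {n} α (ts : Vec (Term S) n) i → lookup (evals I α ts) i ≡ eval I α (lookup ts i)
  lookup-evals α (t ∷ ts) zero    = refl
  lookup-evals α (t ∷ ts) (suc i) = lookup-evals α ts i

  vsum-evals-fromList : ∀ α (us : List (Term S)) → vsum (evals I α (fromList us)) ≡ sum (map (eval I α) us)
  vsum-evals-fromList α []       = refl
  vsum-evals-fromList α (u ∷ us) = ≡.cong (eval I α u +_) (vsum-evals-fromList α us)

module _ {S : Sig} where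

  COM-arg : ∀ i {w} (ws : List (Term (Ext S))) → w ∈ ws → w ⊴ COM i ws
  COM-arg i []           ()
  COM-arg i (u ∷ [])     (here refl) = here
  COM-arg i (u ∷ [])     (there ())
  COM-arg i (u ∷ v ∷ us) w∈ws        = ◁⇒⊴ (arg◁ (∈-fromList⁺ w∈ws))

  COM-occurs⁻ : ∀ j (ws : List (Term (Ext S))) {s us} → fun (orig s) us ⊴ COM j ws →
                Σ (Term (Ext S)) λ w → w ∈ ws × fun (orig s) us ⊴ w
  COM-occurs⁻ j []           (below () _)
  COM-occurs⁻ j (u ∷ [])     p           = u , here refl , p
  COM-occurs⁻ j (u ∷ v ∷ ws) (below i p) = _ , ∈-fromList⁻ (∈ᵥ-lookup i _) , p

  COM-dominates : ∀ (J : Interp (Ext S)) → (∀ s → StrictMono (J s)) → ∀ α i (us : List (Term (Ext S))) →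
                  sum (map (eval J α) us) ≤ eval J α (COM i us)
  COM-dominates J J-mono α i []       = z≤n
  COM-dominates J J-mono α i (u ∷ []) = ≤-reflexive (+-identityʳ _)
  COM-dominates J J-mono α i us@(_ ∷ _ ∷ _) =
    ≤-trans (≤-reflexive (sym (vsum-evals-fromList J α us)))
            (vsum≤ (evalP (J (com i (length us)))) (J-mono (com i (length us))) (evals J α (fromList us)))

module _ {S : Sig} (p : Sym S → Bool) where

  mutual
    caps-⊴ : ∀ v (t : Term S) {u} → u ∈ caps p v t → u ⊴ t
    caps-⊴ true (var x) (here refl) = here
    caps-⊴ true (var x) (there ())
    caps-⊴ v (fun f ts) u∈ with p f
    caps-⊴ v (fun f ts) (here refl) | true = here
    caps-⊴ v (fun f ts) (there ())  | true
    ... | false with capsV-⊴ v ts u∈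
    ...   | i , q = below i q

    capsV-⊴ : ∀ v {n} (ts : Vec (Term S) n) {u} → u ∈ capsV p v ts → Σ (Fin n) λ i → u ⊴ lookup ts i
    capsV-⊴ v (t ∷ ts) u∈ with ∈-++⁻ (caps p v t) u∈
    ... | inj₁ q = zero , caps-⊴ v t q
    ... | inj₂ q with capsV-⊴ v ts q
    ...   | i , r = suc i , r

  mutual
    caps-root : ∀ (t : Term S) {u} → u ∈ caps p false t →
                Σ (Sym S) λ g → Σ _ λ us → u ≡ fun g us × p g ≡ true
    caps-root (fun f ts) u∈ with p f in pf
    caps-root (fun f ts) (here refl) | true = f , ts , refl , pf
    caps-root (fun f ts) (there ())  | true
    ... | false = capsV-root ts u∈

    capsV-root : ∀ {n} (ts : Vec (Term S) n) {u} → u ∈ capsV p false ts →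
                 Σ (Sym S) λ g → Σ _ λ us → u ≡ fun g us × p g ≡ true
    capsV-root (t ∷ ts) u∈ with ∈-++⁻ (caps p false t) u∈
    ... | inj₁ q = caps-root t q
    ... | inj₂ q = capsV-root ts q

module _ {S : Sig} (_≟_ : DecidableEquality (Sym S)) (R : List (Rule S)) where

  isDefined : Sym S → Bool
  isDefined f = ⌊ defined? _≟_ R f ⌋

  isDefined-true : ∀ g → isDefined g ≡ true → Defined R g
  isDefined-true g _ with defined? _≟_ R g
  isDefined-true g _  | yes dg = dg
  isDefined-true g () | no _

  isDefined-false : ∀ g → isDefined g ≡ false → ¬ Defined R g
  isDefined-false g _ with defined? _≟_ R g
  isDefined-false g () | yes _
  isDefined-false g _  | no ng = ng

  own-weak-pair : ∀ v {ρ} (ρ∈R : ρ ∈ R) →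
    Σ (Fin (length R)) λ i → wdpRule _≟_ R v (toℕ (index ρ∈R)) ρ ≡ wdpRule _≟_ R v (toℕ i) (List.lookup R i)
  own-weak-pair v ρ∈R = index ρ∈R , ≡.cong (wdpRule _≟_ R v (toℕ (index ρ∈R))) (lookup-index ρ∈R)

module SymbolsOf {S : Sig} (_≟_ : DecidableEquality (Sym S)) (R : List (Rule S)) where

  mutual
    symbols : Term S → List (Sym S)
    symbols (var x)    = []
    symbols (fun f ts) = f ∷ symbolsV ts

    symbolsV : ∀ {n} → Vec (Term S) n → List (Sym S)
    symbolsV []       = []
    symbolsV (t ∷ ts) = symbols t ++ symbolsV ts

  mutual
    occurs⇒∈symbols : ∀ {s vs} (t : Term S) → fun s vs ⊴ t → s ∈ symbols t
    occurs⇒∈symbols (fun f ts) here        = here refl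
    occurs⇒∈symbols (fun f ts) (below i p) = there (occurs⇒∈symbolsV ts i p)

    occurs⇒∈symbolsV : ∀ {s vs n} (ts : Vec (Term S) n) i → fun s vs ⊴ lookup ts i → s ∈ symbolsV ts
    occurs⇒∈symbolsV (t ∷ ts) zero    p = ∈-++⁺ˡ (occurs⇒∈symbols t p)
    occurs⇒∈symbolsV (t ∷ ts) (suc i) p = ∈-++⁺ʳ (symbols t) (occurs⇒∈symbolsV ts i p)

  symbolsOfRules : List (Rule S) → List (Sym S)
  symbolsOfRules []       = []
  symbolsOfRules (ρ ∷ rs) = symbols (lhs ρ) ++ symbols (rhs ρ) ++ symbolsOfRules rs

  symbolsR : List (Sym S)
  symbolsR = symbolsOfRules R

  rule-symbol∈R : ∀ {ρ s vs} → ρ ∈ R → fun s vs ⊴ lhs ρ ⊎ fun s vs ⊴ rhs ρ → s ∈ symbolsR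
  rule-symbol∈R = go R
    where
    go : ∀ rs {ρ s vs} → ρ ∈ rs → fun s vs ⊴ lhs ρ ⊎ fun s vs ⊴ rhs ρ → s ∈ symbolsOfRules rs
    go (ρ ∷ rs)  (here refl) (inj₁ p) = ∈-++⁺ˡ (occurs⇒∈symbols (lhs ρ) p)
    go (ρ ∷ rs)  (here refl) (inj₂ p) = ∈-++⁺ʳ (symbols (lhs ρ)) (∈-++⁺ˡ (occurs⇒∈symbols (rhs ρ) p))
    go (ρ′ ∷ rs) (there ρ∈)  o        = ∈-++⁺ʳ (symbols (lhs ρ′)) (∈-++⁺ʳ (symbols (rhs ρ′)) (go rs ρ∈ o))

  defined∈R : ∀ {f} → Defined R f → f ∈ symbolsR
  defined∈R df with find df
  ... | ρ , ρ∈R , root≡f with root-occurs (lhs ρ) root≡f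
  ...   | _ , f⊴l = rule-symbol∈R ρ∈R (inj₁ f⊴l)

  OnlyR : Term (Ext S) → Set
  OnlyR t = ∀ {s us} → fun (orig s) us ⊴ t → s ∈ symbolsR

  OnlyRRules : (Rule (Ext S) → Set) → Set
  OnlyRRules P = ∀ ρ′ → P ρ′ → OnlyR (lhs ρ′) × OnlyR (rhs ρ′)

  onlyR-∪ : ∀ {P Q} → OnlyRRules P → OnlyRRules Q → OnlyRRules (P ∪ Q)
  onlyR-∪ onlyP onlyQ ρ′ (inj₁ p) = onlyP ρ′ p
  onlyR-∪ onlyP onlyQ ρ′ (inj₂ q) = onlyQ ρ′ q

  onlyR-U : ∀ P → OnlyRRules (U R P)
  onlyR-U P ρ′ (ρ , ρ∈R , refl , _) =
    (λ p → rule-symbol∈R ρ∈R (inj₁ (proj₂ (lift-occurs⁻ (lhs ρ) p)))) ,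
    (λ p → rule-symbol∈R ρ∈R (inj₂ (proj₂ (lift-occurs⁻ (rhs ρ) p))))

  onlyR-weakPair : ∀ v i → OnlyR (lhs (wdpRule _≟_ R v (toℕ i) (List.lookup R i)))
                          × OnlyR (rhs (wdpRule _≟_ R v (toℕ i) (List.lookup R i)))
  onlyR-weakPair v i = (λ p → rule-symbol∈R ρ∈R (inj₁ (proj₂ (♯-occurs⁻ (lhs ρ) p)))) , onlyR-rhs
    where
    ρ : Rule S
    ρ = List.lookup R i
    ρ∈R : ρ ∈ R
    ρ∈R = ∈-lookup i
    cs : List (Term S)
    cs = caps (isDefined _≟_ R) v (rhs ρ)
    onlyR-rhs : OnlyR (COM (toℕ i) (map _♯ cs))
    onlyR-rhs p with COM-occurs⁻ (toℕ i) (map _♯ cs) p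
    ... | w , w∈ , q with ∈-map⁻ _♯ w∈
    ...   | u , u∈cs , refl = rule-symbol∈R ρ∈R (inj₂ (⊴-trans (proj₂ (♯-occurs⁻ u q)) (caps-⊴ (isDefined _≟_ R) v (rhs ρ) u∈cs)))

  onlyR-WDP : OnlyRRules (WDP _≟_ R)
  onlyR-WDP ρ′ (i , refl) = onlyR-weakPair true i

  onlyR-WIDP : OnlyRRules (WIDP _≟_ R)
  onlyR-WIDP ρ′ (i , refl) = onlyR-weakPair false i

  onlyR-DP : OnlyRRules (DP R)
  onlyR-DP ρ′ (ρ , ρ∈R , u , u⊴r , _ , _ , _ , refl) =
    (λ p → rule-symbol∈R ρ∈R (inj₁ (proj₂ (♯-occurs⁻ (lhs ρ) p)))) ,
    (λ p → rule-symbol∈R ρ∈R (inj₂ (⊴-trans (proj₂ (♯-occurs⁻ u p)) u⊴r)))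

-- J is compatible wherever I is, and all constructor constants of J are
-- bounded by K, which is what makes [t♯] polynomial in the size of t.
module Reinterpretation {S : Sig} (_≟_ : DecidableEquality (Sym S)) (R : List (Rule S))
                        {d : Degree} (I : Interp (Ext S)) (restr : Restricted d R I) where
  open SymbolsOf _≟_ R
  open import Data.List.Membership.DecPropositional _≟_ using (_∈?_)

  I-mono : ∀ s → StrictMono (I s)
  I-mono = proj₁ restr

  I-constructor : ∀ s → IsConstructor R s → StronglyLinearP (I s)
  I-constructor = proj₁ (proj₂ restr)

  I-degree : ∀ s → ¬ IsConstructor R s → DegreeOK d (I s)
  I-degree = proj₂ (proj₂ restr)

  J : Interp (Ext S)
  J (orig s) with s ∈? symbolsR
  ... | yes _ = I (orig s)
  ... | no  _ = sumPoly (ar S s)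
  J (sharp f) = I (sharp f)
  J (com i n) = I (com i n)

  J-mono : ∀ s → StrictMono (J s)
  J-mono (orig s) with s ∈? symbolsR
  ... | yes _ = I-mono (orig s)
  ... | no  _ = stronglyLinear⇒strictMono (sumPoly _) (sumPoly-stronglyLinear _)
  J-mono (sharp f) = I-mono (sharp f)
  J-mono (com i n) = I-mono (com i n)

  J≡I : ∀ s {ts} → OnlyR (fun s ts) → J s ≡ I s
  J≡I (orig s) only with s ∈? symbolsR
  ... | yes _   = refl
  ... | no  s∉R = ⊥-elim (s∉R (only here))
  J≡I (sharp f) only = refl
  J≡I (com i n) only = refl

  mutual
    eval-J≡I : ∀ α t → OnlyR t → eval J α t ≡ eval I α t
    eval-J≡I α (var x)    only = refl
    eval-J≡I α (fun s ts) only = cong₂ evalP (J≡I s only) (evals-J≡I α ts (λ i p → only (below i p)))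

    evals-J≡I : ∀ α {n} (ts : Vec (Term (Ext S)) n) → (∀ i → OnlyR (lookup ts i)) → evals J α ts ≡ evals I α ts
    evals-J≡I α []       only = refl
    evals-J≡I α (t ∷ ts) only = cong₂ _∷_ (eval-J≡I α t (only zero)) (evals-J≡I α ts (only ∘ suc))

  compatible-J : ∀ {P} → OnlyRRules P → Compatible I P → Compatible J P
  compatible-J only compat ρ′ p α =
    subst₂ _<_ (sym (eval-J≡I α (rhs ρ′) (proj₂ (only ρ′ p)))) (sym (eval-J≡I α (lhs ρ′) (proj₁ (only ρ′ p))))
           (compat ρ′ p α)

  K : ℕ
  K = sum (map (λ s → c (I (orig s))) symbolsR)

  J-constructor : ∀ g → ¬ Defined R g → StronglyLinearP (J (orig g)) × c (J (orig g)) ≤ K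
  J-constructor g ng with g ∈? symbolsR
  ... | yes g∈R = I-constructor (orig g) ng , ∈⇒≤sum (λ s → c (I (orig s))) symbolsR g∈R
  ... | no  _   = sumPoly-stronglyLinear _ , z≤n

  mutual
    constructor-value : ∀ t → ConTerm R t → eval J α₀ (lift t) ≤ suc K * size t
    constructor-value (var x)    _           = z≤n
    constructor-value (fun g ts) (fun ng cs) = begin
        evalP (J (orig g)) (evals J α₀ (lifts ts))   ≡⟨ stronglyLinear-eval (J (orig g)) (proj₁ con) (evals J α₀ (lifts ts)) ⟩
        c (J (orig g)) + vsum (evals J α₀ (lifts ts)) ≤⟨ +-mono-≤ (≤-trans (proj₂ con) (n≤1+n K)) (constructor-values ts cs) ⟩
        suc K + suc K * sizes ts                      ≡⟨ sym (*-suc (suc K) (sizes ts)) ⟩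
        suc K * suc (sizes ts)                        ∎
      where
      open ≤-Reasoning
      con : StronglyLinearP (J (orig g)) × c (J (orig g)) ≤ K
      con = J-constructor g ng

    constructor-values : ∀ {n} (ts : Vec (Term S) n) → (∀ i → ConTerm R (lookup ts i)) →
                         vsum (evals J α₀ (lifts ts)) ≤ suc K * sizes ts
    constructor-values []       cs = z≤n
    constructor-values (t ∷ ts) cs = ≤-trans (+-mono-≤ (constructor-value t (cs zero)) (constructor-values ts (cs ∘ suc)))
                                             (≤-reflexive (sym (*-distribˡ-+ (suc K) (size t) (sizes ts))))

  C A B : Sym S → ℕ
  C f = c (I (sharp f))
  A f = sumF (a (I (sharp f)))
  B f = sumF (λ i → sumF (b (I (sharp f)) i))

  Cᵣ Aᵣ Bᵣ : ℕ
  Cᵣ = sum (map C symbolsR)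
  Aᵣ = sum (map A symbolsR)
  Bᵣ = sum (map B symbolsR)

  marked-value-bound : ∀ {f ts n} → Defined R f → (∀ i → ConTerm R (lookup ts i)) → size (fun f ts) ≤ n →
    eval J α₀ (fun f ts ♯) ≤ Cᵣ + Aᵣ * (suc K * n) + B f * ((suc K * n) * (suc K * n))
  marked-value-bound {f} {ts} {n} df cs size≤n = begin
      evalP (I (sharp f)) xs                          ≤⟨ poly-bound (I (sharp f)) xs (vsum xs) (lookup≤vsum xs) ⟩
      C f + A f * vsum xs + B f * (vsum xs * vsum xs) ≤⟨ +-mono-≤ (+-mono-≤ C≤ (*-mono-≤ A≤ xs≤M))
                                                                   (*-monoʳ-≤ (B f) (*-mono-≤ xs≤M xs≤M)) ⟩
      Cᵣ + Aᵣ * M + B f * (M * M)                     ∎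
    where
    open ≤-Reasoning
    xs : Vec ℕ (ar S f)
    xs = evals J α₀ (lifts ts)
    M : ℕ
    M = suc K * n
    xs≤M : vsum xs ≤ M
    xs≤M = ≤-trans (constructor-values ts cs) (*-monoʳ-≤ (suc K) (≤-trans (n≤1+n _) size≤n))
    C≤ : C f ≤ Cᵣ
    C≤ = ∈⇒≤sum C symbolsR (defined∈R df)
    A≤ : A f ≤ Aᵣ
    A≤ = ∈⇒≤sum A symbolsR (defined∈R df)

  marked-basic-bound : ∀ k → ∃[ p ] ∃[ q ] ∃[ r ] ∀ {f ts n} → Defined R f → (∀ i → ConTerm R (lookup ts i)) →
                       size (fun f ts) ≤ n → k + eval J α₀ (fun f ts ♯) ≤ BoundFn d p q r n
  marked-basic-bound k = bound d I-degree
    where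
    open +-*-Solver using (solve; _:+_; _:*_; _:=_; con)
    bound : ∀ d′ → (∀ s → ¬ IsConstructor R s → DegreeOK d′ (I s)) →
            ∃[ p ] ∃[ q ] ∃[ r ] ∀ {f ts n} → Defined R f → (∀ i → ConTerm R (lookup ts i)) →
            size (fun f ts) ≤ n → k + eval J α₀ (fun f ts ♯) ≤ BoundFn d′ p q r n
    bound linear linear-I = Aᵣ * suc K , Cᵣ + k , 0 , λ {f} {ts} {n} df cs size≤n → let M = suc K * n in begin
        k + eval J α₀ (fun f ts ♯)       ≤⟨ +-monoʳ-≤ k (marked-value-bound {ts = ts} df cs size≤n) ⟩
        k + (Cᵣ + Aᵣ * M + B f * (M * M)) ≡⟨ ≡.cong (λ z → k + (Cᵣ + Aᵣ * M + z * (M * M)))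
                                                   (linear-no-quadratic (I (sharp f)) (linear-I (sharp f) (λ ()))) ⟩
        k + (Cᵣ + Aᵣ * M + 0)            ≡⟨ solve 5 (λ k C A K₁ n → k :+ (C :+ A :* (K₁ :* n) :+ con 0)
                                                             := A :* K₁ :* n :+ (C :+ k)) refl k Cᵣ Aᵣ (suc K) n ⟩
        Aᵣ * suc K * n + (Cᵣ + k)        ∎
      where open ≤-Reasoning
    bound quadratic _ = Bᵣ * (suc K * suc K) , Aᵣ * suc K , Cᵣ + k , λ {f} {ts} {n} df cs size≤n → let M = suc K * n in begin
        k + eval J α₀ (fun f ts ♯)       ≤⟨ +-monoʳ-≤ k (marked-value-bound {ts = ts} df cs size≤n) ⟩
        k + (Cᵣ + Aᵣ * M + B f * (M * M)) ≤⟨ +-monoʳ-≤ k (+-monoʳ-≤ (Cᵣ + Aᵣ * M) (*-monoˡ-≤ (M * M) (∈⇒≤sum B symbolsR (defined∈R df)))) ⟩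
        k + (Cᵣ + Aᵣ * M + Bᵣ * (M * M)) ≡⟨ solve 6 (λ k C A B K₁ n → k :+ (C :+ A :* (K₁ :* n) :+ B :* ((K₁ :* n) :* (K₁ :* n)))
                                                             := B :* (K₁ :* K₁) :* (n :* n) :+ A :* K₁ :* n :+ (C :+ k))
                                                   refl k Cᵣ Aᵣ Bᵣ (suc K) n ⟩
        Bᵣ * (suc K * suc K) * (n * n) + Aᵣ * suc K * n + (Cᵣ + k) ∎
      where open ≤-Reasoning

module _ {S : Sig} (R : List (Rule S)) where

  data StepShape (_⇝_ : Term S → Term S → Set) (Side : Rule S → (ℕ → Term S) → Set) (s t : Term S) : Set where
    at-root : ∀ {ρ σ} → ρ ∈ R → Side ρ σ → s ≡ sub σ (lhs ρ) → t ≡ sub σ (rhs ρ) → StepShape _⇝_ Side s t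
    in-arg  : ∀ {f ts} i {u} → s ≡ fun f ts → lookup ts i ⇝ u → t ≡ fun f (ts [ i ]≔ u) → StepShape _⇝_ Side s t

  record Strategy : Set₁ where
    field
      _⇝_   : Term S → Term S → Set
      Side  : Rule S → (ℕ → Term S) → Set
      shape : ∀ {s t} → s ⇝ t → StepShape _⇝_ Side s t
      sound : ∀ {s t} → s ⇝ t → R ⊢ s ⟶ t

  full : Strategy
  full = record { _⇝_ = R ⊢_⟶_ ; Side = λ _ _ → ⊤ ; shape = full-shape ; sound = id }
    where
    full-shape : ∀ {s t} → R ⊢ s ⟶ t → StepShape (R ⊢_⟶_) (λ _ _ → ⊤) s t
    full-shape (root ρ∈R)  = at-root ρ∈R tt refl refl
    full-shape (cong i st) = in-arg i refl st refl

  InnermostRedex : Rule S → (ℕ → Term S) → Set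
  InnermostRedex ρ σ = ∀ u → u ◁ sub σ (lhs ρ) → NF R u

  innermost⇒full : ∀ {s t} → R ⊢ s ⟶ⁱ t → R ⊢ s ⟶ t
  innermost⇒full (root ρ∈R _) = root ρ∈R
  innermost⇒full (cong i st)  = cong i (innermost⇒full st)

  innermost : Strategy
  innermost = record { _⇝_ = R ⊢_⟶ⁱ_ ; Side = InnermostRedex ; shape = innermost-shape ; sound = innermost⇒full }
    where
    innermost-shape : ∀ {s t} → R ⊢ s ⟶ⁱ t → StepShape (R ⊢_⟶ⁱ_) InnermostRedex s t
    innermost-shape (root ρ∈R nf) = at-root ρ∈R nf refl refl
    innermost-shape (cong i st)   = in-arg i refl st refl

  -- Under WDP variables are caps themselves; under WIDP their instances must be normal.
  NormalIf : Bool → Term S → Set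
  NormalIf true  t = ⊤
  NormalIf false t = NF R t

module Measure {S : Sig} (R : List (Rule S)) (trs : IsTRS R) (P : Rule (Ext S) → Set)
               (J : Interp (Ext S)) (J-mono : ∀ s → StrictMono (J s))
               (J-compat : Compatible J (U R P ∪ P)) (k : ℕ) where

  val : Term (Ext S) → ℕ
  val = eval J α₀

  Usable : Sym S → Set
  Usable g = Σ (Sym S) λ g₀ → Star (R ⊢_▷d_) g₀ g × Σ (Rule (Ext S)) λ π → P π × Occurs (orig g₀) (rhs π)

  usable-▷d : ∀ {f g} → Usable f → R ⊢ f ▷d g → Usable g
  usable-▷d (g₀ , g₀▷*f , rest) f▷g = g₀ , g₀▷*f ◅◅ (f▷g ◅ ε) , rest

  AllUsable : Term S → Set
  AllUsable t = ∀ {g us} → Defined R g → fun g us ⊴ t → Usable g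

  ArgsUsable : Term S → Set
  ArgsUsable t = ∀ {g us} → Defined R g → fun g us ◁ t → Usable g

  ArgsUsable-update : ∀ {f} {ts : Vec (Term S) (ar S f)} i {u} →
                      ArgsUsable (fun f ts) → AllUsable u → ArgsUsable (fun f (ts [ i ]≔ u))
  ArgsUsable-update {ts = ts} i args u-usable dg (below j p) with ⊴-update ts i j p
  ... | inj₁ q = u-usable dg q
  ... | inj₂ q = args dg (below j q)

  ArgsUsable-sub : ∀ σ g ts → ArgsUsable (fun g ts) → (∀ x → var x ⊴ fun g ts → AllUsable (σ x)) →
                   ArgsUsable (sub σ (fun g ts))
  ArgsUsable-sub σ g ts args vars dh (below i q) with subs-occurs⁻ σ ts i q
  ... | inj₁ (vs , r)     = args dh (below i r)
  ... | inj₂ (x , x∈ , r) = vars x (below i x∈) dh r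

  rhs-vars-usable : ∀ {ρ σ} → ρ ∈ R → ArgsUsable (sub σ (lhs ρ)) → ∀ x → var x ⊴ rhs ρ → AllUsable (σ x)
  rhs-vars-usable {σ = σ} ρ∈R args x x∈r dg q = args dg (⊴-◁-trans q (rhs-var◁redex trs ρ∈R σ x∈r))

  val-lift-sub : ∀ σ t → val (lift (sub σ t)) ≡ eval J (val ∘ lift ∘ σ) (lift t)
  val-lift-sub σ t = trans (≡.cong val (lift-sub σ t)) (eval-sub J α₀ (lift ∘ σ) (lift t))

  val-♯-sub : ∀ σ g ts → val (sub σ (fun g ts) ♯) ≡ eval J (val ∘ lift ∘ σ) (fun g ts ♯)
  val-♯-sub σ g ts = trans (≡.cong val (♯-sub σ g ts)) (eval-sub J α₀ (lift ∘ σ) (fun g ts ♯))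

  val-♯-redex : ∀ {ρ} → ρ ∈ R → ∀ σ → val (sub σ (lhs ρ) ♯) ≡ eval J (val ∘ lift ∘ σ) (lhs ρ ♯)
  val-♯-redex ρ∈R σ with trs ρ∈R
  ... | (f , ls , lhs≡) , _ = subst (λ l → val (sub σ l ♯) ≡ eval J (val ∘ lift ∘ σ) (l ♯)) (sym lhs≡) (val-♯-sub σ f ls)

  replace-arg< : ∀ s (ts : Vec (Term S) (ar (Ext S) s)) i {u} → val (lift u) < val (lift (lookup ts i)) →
                 evalP (J s) (evals J α₀ (lifts (ts [ i ]≔ u))) < evalP (J s) (evals J α₀ (lifts ts))
  replace-arg< s ts i {u} u< = subst (λ zs → evalP (J s) zs < _) (sym values)
                                 (strictMono-dec (evalP (J s)) (J-mono s) (evals J α₀ (lifts ts)) i _ u<′)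
    where
    values : evals J α₀ (lifts (ts [ i ]≔ u)) ≡ evals J α₀ (lifts ts) [ i ]≔ val (lift u)
    values = trans (≡.cong (evals J α₀) (lifts-update ts i u)) (evals-update J α₀ (lifts ts) i (lift u))
    u<′ : val (lift u) < lookup (evals J α₀ (lifts ts)) i
    u<′ = subst (val (lift u) <_) (sym (trans (lookup-evals J α₀ (lifts ts) i) (≡.cong val (lookup-lifts ts i)))) u<

  -- A step from a term with only usable symbols applies a usable rule: the
  -- value drops by compatibility with U(P), and usability is preserved.
  usable-step : ∀ {s t} → AllUsable s → R ⊢ s ⟶ t → val (lift t) < val (lift s) × AllUsable t
  usable-step all (root {ρ} {σ} ρ∈R) with trs ρ∈R
  ... | (f , ls , lhs≡) , vars⊆ = decrease , rhs-usable
    where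
    f-usable : Usable f
    f-usable = all (lhs-root-defined ρ∈R lhs≡) (subst (λ l → fun f (subs σ ls) ⊴ sub σ l) (sym lhs≡) here)
    ρ-usable : U R P (liftRule ρ)
    ρ-usable = ρ , ρ∈R , refl , f , ≡.cong rootSym lhs≡ , f-usable
    decrease : val (lift (sub σ (rhs ρ))) < val (lift (sub σ (lhs ρ)))
    decrease = subst₂ _<_ (sym (val-lift-sub σ (rhs ρ))) (sym (val-lift-sub σ (lhs ρ)))
                      (J-compat (liftRule ρ) (inj₁ ρ-usable) (val ∘ lift ∘ σ))
    rhs-usable : AllUsable (sub σ (rhs ρ))
    rhs-usable dg p with sub-occurs⁻ σ (rhs ρ) p
    ... | inj₁ (vs , q)     = usable-▷d f-usable (ρ , ρ∈R , ≡.cong rootSym lhs≡ , dg , vs , q)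
    ... | inj₂ (x , x∈ , q) = all dg (⊴-trans q (var⊴⇒⊴sub σ (vars⊆ x x∈)))
  usable-step {fun f ts} all (cong i {u} st) with usable-step (λ dg p → all dg (below i p)) st
  ... | u< , u-usable = replace-arg< (orig f) ts i u< , all′
    where
    all′ : AllUsable (fun f (ts [ i ]≔ u))
    all′ dg here        = all dg here
    all′ dg (below j p) = ArgsUsable-update i (λ dh → all dh ∘ ◁⇒⊴) u-usable dg (below j p)

  -- Weight t v: v bounds the length of every derivation from t (height≤weight).
  mutual
    data Weight : Term S → ℕ → Set where
      usable    : ∀ {s} → AllUsable s → Weight s (val (lift s))
      marked    : ∀ {f ss} → Defined R f → ArgsUsable (fun f ss) → Weight (fun f ss) (k + val (fun f ss ♯))
      normal    : ∀ {s} → NF R s → Weight s 0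
      construct : ∀ {c ss w} → ¬ Defined R c → Weights ss w → Weight (fun c ss) w

    data Weights : ∀ {n} → Vec (Term S) n → ℕ → Set where
      []  : Weights [] 0
      _∷_ : ∀ {n t ts v w} → Weight t v → Weights {n} ts w → Weights (t ∷ ts) (v + w)

  RootObligation : (Rule S → (ℕ → Term S) → Set) → Set
  RootObligation Side = ∀ {ρ σ} → ρ ∈ R → Side ρ σ → ArgsUsable (sub σ (lhs ρ)) →
    Σ ℕ λ v → v < k + val (sub σ (lhs ρ) ♯) × Weight (sub σ (rhs ρ)) v

  module Decrease (st : Strategy R) (root-step : RootObligation (Strategy.Side st)) where
    open Strategy st

    mutual
      weight-decreases : ∀ {s t v} → Weight s v → s ⇝ t → Σ ℕ λ v′ → v′ < v × Weight t v′
      weight-decreases (usable all) st with usable-step all (sound st)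
      ... | t< , all′ = _ , t< , usable all′
      weight-decreases (normal nf) st = ⊥-elim (nf _ (sound st))
      weight-decreases (marked {f} {ss} df args) st with shape st
      ... | at-root ρ∈R side s≡ refl with root-step ρ∈R side (subst ArgsUsable s≡ args)
      ...   | v′ , v′< , w = v′ , subst (λ z → v′ < k + val (z ♯)) (sym s≡) v′< , w
      weight-decreases (marked {f} {ss} df args) st | in-arg i refl st′ refl
        with usable-step (λ dg p → args dg (below i p)) (sound st′)
      ... | u< , u-usable = _ , +-monoʳ-< k (replace-arg< (sharp f) ss i u<) , marked df (ArgsUsable-update i args u-usable)
      weight-decreases (construct nc ws) st with shape st
      ... | at-root ρ∈R _ s≡ _ = ⊥-elim (nc (redex-root-defined trs ρ∈R s≡))
      ... | in-arg i refl st′ refl with weights-decrease ws i st′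
      ...   | w′ , w′< , ws′ = w′ , w′< , construct nc ws′

      weights-decrease : ∀ {n} {ss : Vec (Term S) n} {w} → Weights ss w → ∀ i {u} → lookup ss i ⇝ u →
                         Σ ℕ λ w′ → w′ < w × Weights (ss [ i ]≔ u) w′
      weights-decrease (x ∷ ws) zero st with weight-decreases x st
      ... | v′ , v′< , x′ = _ , +-monoˡ-< _ v′< , x′ ∷ ws
      weights-decrease (x ∷ ws) (suc i) st with weights-decrease ws i st
      ... | w′ , w′< , ws′ = _ , +-monoʳ-< _ w′< , x ∷ ws′

    height≤weight : ∀ {t v n} → Weight t v → Deriv _⇝_ t n → n ≤ v
    height≤weight w stop = z≤n
    height≤weight w (step st der) with weight-decreases w st
    ... | v′ , v′<v , w′ = ≤-trans (s≤s (height≤weight w′ der)) v′<v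

    -- A basic term is a marked term with no defined symbol below its root.
    basic-height : ∀ {f ts n} → Defined R f → (∀ i → ConTerm R (lookup ts i)) →
                   Deriv _⇝_ (fun f ts) n → n ≤ k + val (fun f ts ♯)
    basic-height df cs = height≤weight (marked df no-defined-below)
      where
      no-defined-below : ArgsUsable (fun _ _)
      no-defined-below dg (below i p) = ⊥-elim (conTerm-no-defined (cs i) p dg)

module RhsWeights {S : Sig} (R : List (Rule S)) (trs : IsTRS R) (P : Rule (Ext S) → Set)
                  (J : Interp (Ext S)) (J-mono : ∀ s → StrictMono (J s))
                  (J-compat : Compatible J (U R P ∪ P)) (k : ℕ)
                  (p : Sym S → Bool) (p-true : ∀ g → p g ≡ true → Defined R g)
                  (p-false : ∀ g → p g ≡ false → ¬ Defined R g) (σ : ℕ → Term S) where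
  open Measure R trs P J J-mono J-compat k

  α : ℕ → ℕ
  α x = val (lift (σ x))

  capWeight : Term S → ℕ
  capWeight (var x)    = α x
  capWeight (fun g ts) = k + eval J α (fun g ts ♯)

  -- tσ weighs the total weight of its caps: the context above the caps
  -- consists of constructors, variable caps are usable and non-cap variables
  -- are normal, and marked caps have usable arguments.
  mutual
    caps-weight : ∀ v t → (∀ x → var x ⊴ t → AllUsable (σ x)) → (∀ x → var x ⊴ t → NormalIf R v (σ x)) →
                  (∀ {u} → u ∈ caps p v t → ArgsUsable u) → Weight (sub σ t) (sum (map capWeight (caps p v t)))
    caps-weight true  (var x) vars _ _ = subst (Weight (σ x)) (sym (+-identityʳ _)) (usable (vars x here))
    caps-weight false (var x) _ nfs _  = normal (nfs x here)
    caps-weight v (fun g ts) vars nfs capArgs with p g in pg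
    ... | true  = subst (Weight _) (trans (≡.cong (k +_) (val-♯-sub σ g ts)) (sym (+-identityʳ _)))
                    (marked (p-true g pg) (ArgsUsable-sub σ g ts (capArgs (here refl)) vars))
    ... | false = construct (p-false g pg)
                    (capsV-weight v ts (λ x i q → vars x (below i q)) (λ x i q → nfs x (below i q)) capArgs)

    capsV-weight : ∀ v {n} (ts : Vec (Term S) n) → (∀ x i → var x ⊴ lookup ts i → AllUsable (σ x)) →
                   (∀ x i → var x ⊴ lookup ts i → NormalIf R v (σ x)) →
                   (∀ {u} → u ∈ capsV p v ts → ArgsUsable u) → Weights (subs σ ts) (sum (map capWeight (capsV p v ts)))
    capsV-weight v []       _ _ _ = []
    capsV-weight v (t ∷ ts) vars nfs capArgs = subst (Weights _) (sym split)
        (caps-weight v t (λ x → vars x zero) (λ x → nfs x zero) (capArgs ∘ ∈-++⁺ˡ) ∷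
         capsV-weight v ts (λ x → vars x ∘ suc) (λ x → nfs x ∘ suc) (capArgs ∘ ∈-++⁺ʳ (caps p v t)))
      where
      split : sum (map capWeight (caps p v t ++ capsV p v ts)) ≡ sum (map capWeight (caps p v t)) + sum (map capWeight (capsV p v ts))
      split = trans (≡.cong sum (map-++ capWeight (caps p v t) _)) (sum-++ (map capWeight (caps p v t)) _)

  capWeights-unmarked : k ≡ 0 → ∀ cs → sum (map capWeight cs) ≡ sum (map (eval J α) (map _♯ cs))
  capWeights-unmarked k≡0  []               = refl
  capWeights-unmarked k≡0  (var x ∷ cs)     = ≡.cong (α x +_) (capWeights-unmarked k≡0 cs)
  capWeights-unmarked refl (fun g ts ∷ cs)  = ≡.cong (eval J α (fun g ts ♯) +_) (capWeights-unmarked refl cs)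

module RootSteps {S : Sig} (_≟_ : DecidableEquality (Sym S)) (R : List (Rule S)) (trs : IsTRS R)
                 (J : Interp (Ext S)) (J-mono : ∀ s → StrictMono (J s)) where

  -- WDP (v = true) and WIDP (v = false): the weak pair l♯ → COM(u₁♯,…,uₙ♯) of
  -- the applied rule pays for the root step, as COM dominates Σ [uᵢ♯].
  weak-pair-root : ∀ v (P : Rule (Ext S) → Set) →
    (∀ {ρ} (ρ∈R : ρ ∈ R) → P (wdpRule _≟_ R v (toℕ (index ρ∈R)) ρ)) → (J-compat : Compatible J (U R P ∪ P)) →
    (Side : Rule S → (ℕ → Term S) → Set) → (∀ {ρ σ} → Side ρ σ → ∀ x → σ x ◁ sub σ (lhs ρ) → NormalIf R v (σ x)) →
    Measure.RootObligation R trs P J J-mono J-compat 0 Side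
  weak-pair-root v P own-pair∈P J-compat Side side-normal {ρ} {σ} ρ∈R side args =
      sum (map capWeight cs) , decrease ,
      caps-weight v (rhs ρ) (rhs-vars-usable ρ∈R args)
                  (λ x x∈r → side-normal side x (rhs-var◁redex trs ρ∈R σ x∈r)) caps-args-usable
    where
    open Measure R trs P J J-mono J-compat 0
    open RhsWeights R trs P J J-mono J-compat 0 (isDefined _≟_ R) (isDefined-true _≟_ R) (isDefined-false _≟_ R) σ
    i : ℕ
    i = toℕ (index ρ∈R)
    cs : List (Term S)
    cs = caps (isDefined _≟_ R) v (rhs ρ)
    decrease : sum (map capWeight cs) < val (sub σ (lhs ρ) ♯)
    decrease = begin-strict
      sum (map capWeight cs)             ≡⟨ capWeights-unmarked refl cs ⟩
      sum (map (eval J α) (map _♯ cs))   ≤⟨ COM-dominates J J-mono α i (map _♯ cs) ⟩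
      eval J α (COM i (map _♯ cs))       <⟨ J-compat _ (inj₂ (own-pair∈P ρ∈R)) α ⟩
      eval J α (lhs ρ ♯)                 ≡⟨ sym (val-♯-redex ρ∈R σ) ⟩
      val (sub σ (lhs ρ) ♯)              ∎
      where open ≤-Reasoning
    -- symbols below a cap occur in the right-hand side of the pair, so are usable
    caps-args-usable : ∀ {u} → u ∈ cs → ArgsUsable u
    caps-args-usable u∈cs {h} {us} _ q =
      h , ε , _ , own-pair∈P ρ∈R , lifts us , ⊴-trans (♯-occurs⁺ q) (COM-arg i (map _♯ cs) (∈-map⁺ _♯ u∈cs))

  nullary-COM : ∀ j (cs : List (Term S)) → (∀ n → Occurs (com j n) (COM j (map _♯ cs)) → n ≡ 0) →
                cs ≡ [] ⊎ Σ (Term S) λ u → cs ≡ u ∷ []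
  nullary-COM j []           _       = inj₁ refl
  nullary-COM j (u ∷ [])     _       = inj₂ (u , refl)
  nullary-COM j (u ∷ v ∷ cs) nullary with nullary _ (_ , here)
  ... | ()

  -- DP with nullary compound symbols in WIDP: the rule has at most one
  -- defined cap u, and the dependency pair l♯ → u♯ pays for the step; the
  -- extra cost k = 1 covers the case without caps.
  dp-root : CompoundsNullary (WIDP _≟_ R) → (J-compat : Compatible J (U R (DP R) ∪ DP R)) →
            Measure.RootObligation R trs (DP R) J J-mono J-compat 1 (InnermostRedex R)
  dp-root nullary J-compat {ρ} {σ} ρ∈R innermost args = at-most-one-cap (nullary-COM i cs single)
    where
    open Measure R trs (DP R) J J-mono J-compat 1
    open RhsWeights R trs (DP R) J J-mono J-compat 1 (isDefined _≟_ R) (isDefined-true _≟_ R) (isDefined-false _≟_ R) σ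
    i : ℕ
    i = toℕ (index ρ∈R)
    cs : List (Term S)
    cs = caps (isDefined _≟_ R) false (rhs ρ)
    single : ∀ n → Occurs (com i n) (COM i (map _♯ cs)) → n ≡ 0
    single n occ = nullary _ (own-weak-pair _≟_ R false ρ∈R) i n (inj₂ occ)
    pair : ∀ {u} → u ∈ cs → DP R ((lhs ρ ♯) ⇒ (u ♯))
    pair {u} u∈cs with caps-root (isDefined _≟_ R) (rhs ρ) u∈cs
    ... | g , _ , u≡ , pg = ρ , ρ∈R , u , caps-⊴ (isDefined _≟_ R) false (rhs ρ) u∈cs ,
                            g , ≡.cong rootSym u≡ , isDefined-true _≟_ R g pg , refl
    weight : Weight (sub σ (rhs ρ)) (sum (map capWeight cs))
    weight = caps-weight false (rhs ρ) (rhs-vars-usable ρ∈R args)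
               (λ x x∈r → innermost (σ x) (rhs-var◁redex trs ρ∈R σ x∈r))
               (λ u∈cs {h} {us} _ q → h , ε , _ , pair u∈cs , lifts us , ♯-occurs⁺ q)
    at-most-one-cap : cs ≡ [] ⊎ Σ (Term S) (λ u → cs ≡ u ∷ []) →
                      Σ ℕ λ v → v < 1 + val (sub σ (lhs ρ) ♯) × Weight (sub σ (rhs ρ)) v
    at-most-one-cap (inj₁ cs≡) = 0 , s≤s z≤n , subst (λ c → Weight _ (sum (map capWeight c))) cs≡ weight
    at-most-one-cap (inj₂ (u , cs≡)) with caps-root (isDefined _≟_ R) (rhs ρ) (subst (u ∈_) (sym cs≡) (here refl))
    ... | g , us , refl , _ = capWeight u + 0 , s≤s decrease , subst (λ c → Weight _ (sum (map capWeight c))) cs≡ weight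
      where
      decrease : eval J α (u ♯) + 0 < val (sub σ (lhs ρ) ♯)
      decrease = subst₂ _<_ (sym (+-identityʳ _)) (sym (val-♯-redex ρ∈R σ))
                        (J-compat _ (inj₂ (pair (subst (u ∈_) (sym cs≡) (here refl)))) α)

rc-bounded : ∀ {S : Sig} (_≟_ : DecidableEquality (Sym S)) (R : List (Rule S)) (trs : IsTRS R) (d : Degree)
  (P : Rule (Ext S) → Set) → SymbolsOf.OnlyRRules _≟_ R P →
  (∃ λ I → Restricted d R I × Compatible I (U R P ∪ P)) → (k : ℕ) (st : Strategy R) →
  (∀ J J-mono J-compat → Measure.RootObligation R trs P J J-mono J-compat k (Strategy.Side st)) →
  RcBounded d R (Strategy._⇝_ st)
rc-bounded _≟_ R trs d P onlyR-P (I , restr , compat) k st root-step =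
  let p , q , r , value≤ = marked-basic-bound k
  in p , q , r , λ { n t (f , ts , refl , df , cs) size≤n m der →
                       ≤-trans (basic-height {ts = ts} df cs der) (value≤ {ts = ts} df cs size≤n) }
  where
  open SymbolsOf _≟_ R
  open Reinterpretation _≟_ R I restr
  J-compat : Compatible J (U R P ∪ P)
  J-compat = compatible-J (onlyR-∪ (onlyR-U P) onlyR-P) compat
  open Measure R trs P J J-mono J-compat k
  open Decrease st (root-step J J-mono J-compat)

mainTheorem13 : (S : Sig) (_≟_ : DecidableEquality (Sym S)) (R : List (Rule S)) →
    IsTRS R → (d : Degree) →
    ((∃ λ I → Restricted d R I × Compatible I (U R (WDP _≟_ R) ∪ WDP _≟_ R)) →
      RcBounded d R (R ⊢_⟶_))
    × ((∃ λ I → Restricted d R I × Compatible I (U R (WIDP _≟_ R) ∪ WIDP _≟_ R)) →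
      RcBounded d R (R ⊢_⟶ⁱ_))
    × (CompoundsNullary (WIDP _≟_ R) →
       (∃ λ I → Restricted d R I × Compatible I (U R (DP R) ∪ DP R)) →
      RcBounded d R (R ⊢_⟶ⁱ_))
mainTheorem13 S _≟_ R trs d =
    (λ compatible → rc-bounded _≟_ R trs d (WDP _≟_ R) onlyR-WDP compatible 0 (full R)
       (λ J J-mono J-compat → RootSteps.weak-pair-root _≟_ R trs J J-mono true (WDP _≟_ R)
                                (own-weak-pair _≟_ R true) J-compat (λ _ _ → ⊤) (λ _ _ _ → tt)))
  , (λ compatible → rc-bounded _≟_ R trs d (WIDP _≟_ R) onlyR-WIDP compatible 0 (innermost R)
       (λ J J-mono J-compat → RootSteps.weak-pair-root _≟_ R trs J J-mono false (WIDP _≟_ R)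
                                (own-weak-pair _≟_ R false) J-compat (InnermostRedex R)
                                (λ innermost-redex x → innermost-redex _)))
  , (λ nullary compatible → rc-bounded _≟_ R trs d (DP R) onlyR-DP compatible 1 (innermost R)
       (λ J J-mono J-compat → RootSteps.dp-root _≟_ R trs J J-mono nullary J-compat))
  where open SymbolsOf _≟_ R
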